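{- Let $k$ and $r$ be positive integers with $r \ge 2$, $r \mid k$ and $k \ge 2r$. Let $\chi : \{1, 2, \ldots, rk-2r+1\} \to \{0,1\}$ be a 2-coloring such that $\chi(1) = \chi(r-1) = 0$. Then there exists a solution $(\hat{x}_1, \ldots, \hat{x}_k)$ of the equation $x_1 + \cdots + x_{k-1} = x_k$ with all $\hat{x}_i \in \{1, \ldots, rk-2r+1\}$ such that $\sum_{i=1}^k \chi(\hat{x}_i) \equiv 0 \pmod{r}$.
   Context: A solution $(\hat{x}_1,\ldots,\hat{x}_k)$ is called $r$-zero-sum under $\chi$ if $\sum_{i=1}^k \chi(\hat{x}_i) \equiv 0 \pmod r$. -}

module Defs where

open import Data.Nat using (ℕ; zero; suc; _+_; _*_; _∸_; _≤_)
open import Data.Fin using (Fin; inject₁; fromℕ)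
import Data.Fin as F
open import Data.Empty using (⊥)
open import Data.Product using (_×_)
open import Relation.Binary.PropositionalEquality using (_≡_)

bound : ℕ → ℕ → ℕ
bound r k = r * k ∸ 2 * r + 1

InRange : ℕ → ℕ → Set
InRange N x = (1 ≤ x) × (x ≤ N)

sumFin : (n : ℕ) → (Fin n → ℕ) → ℕ
sumFin zero    f = 0
sumFin (suc n) f = f F.zero + sumFin n (λ i → f (F.suc i))

-- x = (x_1,...,x_k) (0-based indices 0..k-1) solves x_1 + ... + x_{k-1} = x_k.
-- For k = 0 there is no such tuple (never used: the theorem has k ≥ 2r ≥ 4).
IsSolution : (k : ℕ) → (Fin k → ℕ) → Set
IsSolution zero    x = ⊥
IsSolution (suc m) x = sumFin m (λ i → x (inject₁ i)) ≡ x (fromℕ m)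

-- Write r = 2 + s, k = q r with q = 2 + p, and N = r (k − 2) + 1. Three explicit solutions
-- cover every colouring with χ 1 = χ (r − 1) = 0, the last entry always being the sum.
-- If χ (k − 1) = 0, take k − 1 ones: every entry has colour 0.
-- If χ N = 0, take r copies of v = (q − 1)(r − 1) + 1, r − 1 copies of r − 1 and k − 2r ones,
-- which sum to N; only the r copies of v can have colour 1, so the colour sum is r χ(v).
-- If χ (k − 1) = χ N = 1, take r − 1 copies of k − 1 and k − r ones, again summing to N;
-- the colour sum is (r − 1) + 1 = r.
module Submission where

open import Defs
open import Data.Nat using (ℕ; zero; suc; _+_; _*_; _∸_; _≤_; z≤n; s≤s)
open import Data.Nat.Properties
  using (≤-refl; ≤-trans; m≤m+n; m≤n+m; m≤n*m; +-assoc; +-comm; +-identityʳ; *-identityʳ; *-zeroʳ; m+n∸m≡n; *-cancelʳ-≤)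
open import Data.Nat.Divisibility using (_∣_; divides; _∣0; ∣-refl; m∣m*n; ∣n⇒∣m*n; ∣m∣n⇒∣m+n)
open import Data.Nat.Tactic.RingSolver using (solve-∀)
open import Data.Fin using (Fin; toℕ; zero; suc; inject₁; fromℕ)
open import Data.Vec using (Vec; []; _∷_; _∷ʳ_; _++_; lookup; map; replicate; sum)
open import Data.Vec.Properties using (lookup-map; map-++; map-id; sum-++)
open import Data.Vec.Relation.Unary.All as All using (All; []; _∷_)
open import Data.Vec.Relation.Unary.All.Properties using (++⁺)
open import Data.Product using (Σ-syntax; _×_; _,_; proj₂)
open import Function using (_∘_; id)
open import Relation.Binary.PropositionalEquality
  using (_≡_; refl; sym; trans; cong; cong₂; subst; module ≡-Reasoning)

ZeroSumSolution : (r N k : ℕ) → (ℕ → Fin 2) → Set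
ZeroSumSolution r N k χ = Σ[ x ∈ (Fin k → ℕ) ]
  (((i : Fin k) → InRange N (x i)) ×
   IsSolution k x ×
   r ∣ sumFin k (λ i → toℕ (χ (x i))))

sumFin-cong : ∀ n {f g : Fin n → ℕ} → (∀ i → f i ≡ g i) → sumFin n f ≡ sumFin n g
sumFin-cong zero    f≗g = refl
sumFin-cong (suc n) f≗g = cong₂ _+_ (f≗g zero) (sumFin-cong n (f≗g ∘ suc))

sumFin-lookup : ∀ {n} (v : Vec ℕ n) → sumFin n (lookup v) ≡ sum v
sumFin-lookup []      = refl
sumFin-lookup (x ∷ v) = cong (x +_) (sumFin-lookup v)

sumFin-init-last : ∀ n (f : Fin (suc n) → ℕ) →
                   sumFin (suc n) f ≡ sumFin n (f ∘ inject₁) + f (fromℕ n)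
sumFin-init-last zero    f = +-identityʳ (f zero)
sumFin-init-last (suc n) f =
  trans (cong (f zero +_) (sumFin-init-last n (f ∘ suc))) (sym (+-assoc (f zero) _ _))

module _ {A : Set} where

  lookup-∷ʳ-inject₁ : ∀ {n} (v : Vec A n) y i → lookup (v ∷ʳ y) (inject₁ i) ≡ lookup v i
  lookup-∷ʳ-inject₁ (x ∷ v) y zero    = refl
  lookup-∷ʳ-inject₁ (x ∷ v) y (suc i) = lookup-∷ʳ-inject₁ v y i

  lookup-∷ʳ-fromℕ : ∀ {n} (v : Vec A n) y → lookup (v ∷ʳ y) (fromℕ n) ≡ y
  lookup-∷ʳ-fromℕ []      y = refl
  lookup-∷ʳ-fromℕ (x ∷ v) y = lookup-∷ʳ-fromℕ v y

  module _ {P : A → Set} where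

    lookup-∷ʳ⁺ : ∀ {n} {v : Vec A n} {y} → All P v → P y → ∀ i → P (lookup (v ∷ʳ y) i)
    lookup-∷ʳ⁺ []        py zero    = py
    lookup-∷ʳ⁺ (px ∷ pv) py zero    = px
    lookup-∷ʳ⁺ (px ∷ pv) py (suc i) = lookup-∷ʳ⁺ pv py i

    replicate⁺ : ∀ {x} → P x → ∀ n → All P (replicate n x)
    replicate⁺ px zero    = []
    replicate⁺ px (suc n) = px ∷ replicate⁺ px n

All-≤-sum : ∀ {n} (v : Vec ℕ n) → All (_≤ sum v) v
All-≤-sum []      = []
All-≤-sum (x ∷ v) =
  m≤m+n x (sum v) ∷ All.map (λ y≤ → ≤-trans y≤ (m≤n+m (sum v) x)) (All-≤-sum v)

sum-map-++ : ∀ {m n} (g : ℕ → ℕ) (u : Vec ℕ m) (w : Vec ℕ n) →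
             sum (map g (u ++ w)) ≡ sum (map g u) + sum (map g w)
sum-map-++ g u w = trans (cong sum (map-++ g u w)) (sum-++ (map g u))

sum-map-replicate : (g : ℕ → ℕ) (a c : ℕ) → sum (map g (replicate a c)) ≡ a * g c
sum-map-replicate g zero    c = refl
sum-map-replicate g (suc a) c = cong (g c +_) (sum-map-replicate g a c)

module _ (r N : ℕ) (χ : ℕ → Fin 2) where

  fromSummands : ∀ {n} (v : Vec ℕ n) → All (1 ≤_) v → InRange N (sum v) →
                 r ∣ sum (map (toℕ ∘ χ) v) + toℕ (χ (sum v)) →
                 ZeroSumSolution r N (suc n) χ
  fromSummands {n} v positive sum∈N r∣colours = x , x∈N , solves , zeroSum
    where
    colour : ℕ → ℕ
    colour = toℕ ∘ χ

    x : Fin (suc n) → ℕ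
    x = lookup (v ∷ʳ sum v)

    x-inject₁ : ∀ i → x (inject₁ i) ≡ lookup v i
    x-inject₁ = lookup-∷ʳ-inject₁ v (sum v)

    x-last : x (fromℕ n) ≡ sum v
    x-last = lookup-∷ʳ-fromℕ v (sum v)

    x∈N : ∀ i → InRange N (x i)
    x∈N = lookup-∷ʳ⁺ (All.zip (positive , All.map (λ y≤ → ≤-trans y≤ (proj₂ sum∈N)) (All-≤-sum v)))
                     sum∈N

    solves : IsSolution (suc n) x
    solves = trans (sumFin-cong n x-inject₁) (trans (sumFin-lookup v) (sym x-last))

    open ≡-Reasoning

    colourSum : sumFin (suc n) (colour ∘ x) ≡ sum (map colour v) + colour (sum v)
    colourSum = begin
      sumFin (suc n) (colour ∘ x)                             ≡⟨ sumFin-init-last n (colour ∘ x) ⟩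
      sumFin n (colour ∘ x ∘ inject₁) + colour (x (fromℕ n))  ≡⟨ cong₂ _+_ (sumFin-cong n colour-inject₁) (cong colour x-last) ⟩
      sumFin n (lookup (map colour v)) + colour (sum v)       ≡⟨ cong (_+ colour (sum v)) (sumFin-lookup (map colour v)) ⟩
      sum (map colour v) + colour (sum v)                     ∎
      where
      colour-inject₁ : ∀ i → colour (x (inject₁ i)) ≡ lookup (map colour v) i
      colour-inject₁ i = trans (cong colour (x-inject₁ i)) (sym (lookup-map i colour v))

    zeroSum : r ∣ sumFin (suc n) (colour ∘ x)
    zeroSum = subst (r ∣_) (sym colourSum) r∣colours

blocks : (a c b d e : ℕ) → Vec ℕ (a + (b + e))
blocks a c b d e = replicate a c ++ (replicate b d ++ replicate e 1)

sum-map-blocks : (g : ℕ → ℕ) (a c b d e : ℕ) →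
                 sum (map g (blocks a c b d e)) ≡ a * g c + (b * g d + e * g 1)
sum-map-blocks g a c b d e =
  trans (sum-map-++ g (replicate a c) _)
        (cong₂ _+_ (sum-map-replicate g a c)
                   (trans (sum-map-++ g (replicate b d) _)
                          (cong₂ _+_ (sum-map-replicate g b d) (sum-map-replicate g e 1))))

module Construction (s p : ℕ) (χ : ℕ → Fin 2) (χ1≡0 : χ 1 ≡ zero) where

  r k k-2 k-1 N : ℕ
  r   = 2 + s
  k   = (2 + p) * r
  k-2 = 2 + 2 * s + 2 * p + p * s
  k-1 = suc k-2
  N   = suc (r * k-2)

  colour : ℕ → ℕ
  colour = toℕ ∘ χ

  bound≡N : bound r k ≡ N
  bound≡N = begin
    r * k ∸ 2 * r + 1            ≡⟨ cong (λ m → m ∸ 2 * r + 1) (expand s p) ⟩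
    2 * r + r * k-2 ∸ 2 * r + 1  ≡⟨ cong (_+ 1) (m+n∸m≡n (2 * r) (r * k-2)) ⟩
    r * k-2 + 1                  ≡⟨ +-comm (r * k-2) 1 ⟩
    N                            ∎
    where
    open ≡-Reasoning
    expand : ∀ s p → (2 + s) * ((2 + p) * (2 + s)) ≡ 2 * (2 + s) + (2 + s) * (2 + 2 * s + 2 * p + p * s)
    expand = solve-∀

  -- The e ones drop out of the colour sum since χ 1 = 0.
  fromBlocks : ∀ a c b d e → 1 ≤ c → 1 ≤ d → suc (a + (b + e)) ≡ k →
               ∀ T → a * c + (b * d + e * 1) ≡ T → InRange N T →
               r ∣ a * colour c + b * colour d + colour T →
               ZeroSumSolution r N k χ
  fromBlocks a c b d e 1≤c 1≤d length≡k T sum≡T T∈N r∣colours =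
    subst (λ m → ZeroSumSolution r N m χ) length≡k
      (fromSummands r N χ v positive (subst (InRange N) (sym sumv≡T) T∈N)
        (subst (r ∣_) (sym (cong₂ _+_ colours (cong colour sumv≡T))) r∣colours))
    where
    v = blocks a c b d e

    positive : All (1 ≤_) v
    positive = ++⁺ (replicate⁺ 1≤c a) (++⁺ (replicate⁺ 1≤d b) (replicate⁺ (s≤s z≤n) e))

    sumv≡T : sum v ≡ T
    sumv≡T = trans (sym (cong sum (map-id v))) (trans (sum-map-blocks id a c b d e) sum≡T)

    open ≡-Reasoning

    colours : sum (map colour v) ≡ a * colour c + b * colour d
    colours = begin
      sum (map colour v)                             ≡⟨ sum-map-blocks colour a c b d e ⟩
      a * colour c + (b * colour d + e * colour 1)   ≡⟨ cong (λ z → a * colour c + (b * colour d + e * toℕ z)) χ1≡0 ⟩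
      a * colour c + (b * colour d + e * 0)          ≡⟨ cong (λ z → a * colour c + (b * colour d + z)) (*-zeroʳ e) ⟩
      a * colour c + (b * colour d + 0)              ≡⟨ cong (a * colour c +_) (+-identityʳ (b * colour d)) ⟩
      a * colour c + b * colour d                    ∎

  χ[k-1]≡0⇒zeroSum : χ k-1 ≡ zero → ZeroSumSolution r N k χ
  χ[k-1]≡0⇒zeroSum χ[k-1]≡0 =
    fromBlocks 0 1 0 1 k-1 (s≤s z≤n) (s≤s z≤n) (length s p) k-1 (*-identityʳ k-1)
      (s≤s z≤n , s≤s (m≤n*m k-2 r)) r∣colours
    where
    length : ∀ s p → suc (3 + 2 * s + 2 * p + p * s) ≡ (2 + p) * (2 + s)
    length = solve-∀
    r∣colours : r ∣ 0 * colour 1 + 0 * colour 1 + colour k-1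
    r∣colours = subst (r ∣_) (cong toℕ (sym χ[k-1]≡0)) (r ∣0)

  χN≡0⇒zeroSum : χ (suc s) ≡ zero → χ N ≡ zero → ZeroSumSolution r N k χ
  χN≡0⇒zeroSum χ[r-1]≡0 χN≡0 =
    fromBlocks r v (suc s) (suc s) (p * r) (s≤s z≤n) (s≤s z≤n) (length s p) N (total s p)
      (s≤s z≤n , ≤-refl) r∣colours
    where
    v = 2 + s + p + p * s
    length : ∀ s p → suc ((2 + s) + (suc s + p * (2 + s))) ≡ (2 + p) * (2 + s)
    length = solve-∀
    total : ∀ s p → (2 + s) * (2 + s + p + p * s) + (suc s * suc s + p * (2 + s) * 1)
                    ≡ suc ((2 + s) * (2 + 2 * s + 2 * p + p * s))
    total = solve-∀
    r∣colours : r ∣ r * colour v + suc s * colour (suc s) + colour N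
    r∣colours =
      subst (r ∣_) (cong₂ (λ a b → r * colour v + suc s * a + b) (cong toℕ (sym χ[r-1]≡0)) (cong toℕ (sym χN≡0)))
        (∣m∣n⇒∣m+n (∣m∣n⇒∣m+n (m∣m*n (colour v)) (∣n⇒∣m*n (suc s) (r ∣0))) (r ∣0))

  χ[k-1]≡1⇒χN≡1⇒zeroSum : χ k-1 ≡ suc zero → χ N ≡ suc zero → ZeroSumSolution r N k χ
  χ[k-1]≡1⇒χN≡1⇒zeroSum χ[k-1]≡1 χN≡1 =
    fromBlocks (suc s) k-1 0 1 (suc p * r) (s≤s z≤n) (s≤s z≤n) (length s p) N (total s p)
      (s≤s z≤n , ≤-refl) r∣colours
    where
    length : ∀ s p → suc (suc s + suc p * (2 + s)) ≡ (2 + p) * (2 + s)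
    length = solve-∀
    total : ∀ s p → suc s * (3 + 2 * s + 2 * p + p * s) + suc p * (2 + s) * 1
                    ≡ suc ((2 + s) * (2 + 2 * s + 2 * p + p * s))
    total = solve-∀
    r≡colours : ∀ s → 2 + s ≡ suc s * 1 + 0 + 1
    r≡colours = solve-∀
    r∣colours : r ∣ suc s * colour k-1 + 0 * colour 1 + colour N
    r∣colours =
      subst (r ∣_) (trans (r≡colours s) (cong₂ (λ a b → suc s * a + 0 + b) (cong toℕ (sym χ[k-1]≡1)) (cong toℕ (sym χN≡1))))
        ∣-refl

  zeroSumSolution : χ (suc s) ≡ zero → ZeroSumSolution r (bound r k) k χ
  zeroSumSolution χ[r-1]≡0 = subst (λ M → ZeroSumSolution r M k χ) (sym bound≡N) solution
    where
    solution : ZeroSumSolution r N k χ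
    solution with χ k-1 in χ[k-1] | χ N in χN
    ... | zero     | _        = χ[k-1]≡0⇒zeroSum χ[k-1]
    ... | suc zero | zero     = χN≡0⇒zeroSum χ[r-1]≡0 χN
    ... | suc zero | suc zero = χ[k-1]≡1⇒χN≡1⇒zeroSum χ[k-1] χN

lemma1 : (k r : ℕ) → 2 ≤ r → r ∣ k → 2 * r ≤ k →
    (χ : ℕ → Fin 2) → χ 1 ≡ zero → χ (r ∸ 1) ≡ zero →
    Σ[ x ∈ (Fin k → ℕ) ]
      (((i : Fin k) → InRange (bound r k) (x i)) ×
       IsSolution k x ×
       r ∣ sumFin k (λ i → toℕ (χ (x i))))
lemma1 _ r@(suc (suc s)) (s≤s (s≤s z≤n)) (divides q refl) 2r≤k χ χ1≡0 χ[r-1]≡0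
  with *-cancelʳ-≤ 2 q r 2r≤k
... | s≤s (s≤s {n = p} z≤n) = Construction.zeroSumSolution s p χ χ1≡0 χ[r-1]≡0
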